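{- Suppose $n=ck$ with $c,k\in\mathbb{N}$ and $k$ odd, and let $L=(2^n+1)/(2^c+1)$. The injective group homomorphism $\mathbb{Z}/(2^c+1)\to\mathbb{Z}/(2^n+1)$, $\alpha\mapsto L\alpha$, induces a bijection $\sigma\mapsto\sigma_L:=L\sigma$ between orbits of $\mathbb{Z}/(2^c+1)-\{0\}$ under multiplication by $2$ and orbits of $L\mathbb{Z}/(2^n+1)-\{0\}$ under multiplication by $2$, and $\mathbb{D}(\sigma_L)\simeq\mathbb{D}(\sigma)$ as $\mathbb{E}$-modules.
   Context: For any $N\ge1$: identify $\mathbb{Z}/(2^N+1)-\{0\}$ with $\{1,\dots,2^N\}$; an orbit under multiplication by $2$ is written as a cyclic sequence $\sigma=(\sigma_1,\dots,\sigma_r)$ with $\sigma_{i+1}\equiv2\sigma_i\bmod 2^N+1$, indices mod $r$. $\sigma_i$ is a local maximum if $\sigma_{i-1}<\sigma_i>\sigma_{i+1}$ and a local minimum if $\sigma_{i-1}>\sigma_i<\sigma_{i+1}$ (as integers); ${\rm Max}(\sigma),{\rm Min}(\sigma)$ are these sets. For $s=\sigma_i\in{\rm Min}(\sigma)$: $\ell(s)=\min\{j\ge1:\sigma_{i-j}\in{\rm Max}(\sigma)\}$, $\rho(s)=\min\{j\ge1:\sigma_{i+j}\in{\rm Max}(\sigma)\}$, $L(s)=\sigma_{i-\ell(s)}$, $R(s)=\sigma_{i+\rho(s)}$. With $k$ an algebraically closed field of characteristic $p$ and $\mathbb{E}=k[F,V]$ the non-commutative ring with $FV=VF=0$, $F\lambda=\lambda^pF$,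 $\lambda V=V\lambda^p$, $\mathbb{D}(\sigma)$ is the quotient of the free left $\mathbb{E}$-module on generators $e_s$ ($s\in{\rm Max}(\sigma)$) by the left submodule generated by $V^{\ell(s)}e_{L(s)}+F^{\rho(s)}e_{R(s)}$, $s\in{\rm Min}(\sigma)$. -}

module Defs where

open import Level using (Level; _⊔_) renaming (suc to lsuc)
open import Algebra.Bundles using (CommutativeRing)
open import Data.Nat using (ℕ; zero; suc)
import Data.Nat as Nat
open import Data.Bool using (Bool; true; false; _∧_; if_then_else_)
open import Data.List using (List; []; _∷_; map; replicate; _++_)
open import Data.Product using (Σ; _×_; _,_)
open import Relation.Nullary using (¬_; does)
open import Relation.Binary.PropositionalEquality using (_≡_)

module Orbits where
  open Nat using (_+_; _*_; _∸_; _^_; _%_; _<_; _≤_; _<?_; _≟_)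

  -- Part 1: orbits of multiplication by 2 on ℤ/(2^N+1) - {0}
  -- Elements of ℤ/(2^N+1) - {0} are represented by 1,…,2^N.

  modulus : ℕ → ℕ
  modulus N = suc (2 ^ N)

  seq : ℕ → ℕ → ℕ → ℕ
  seq N a i = (2 ^ i * a) % modulus N

  -- least j ∈ {1,…,b} with P j (default b if none; never used below,
  -- since all searches are over ranges where a witness exists)
  searchFrom : (ℕ → Bool) → ℕ → ℕ → ℕ → ℕ
  searchFrom P j zero d = d
  searchFrom P j (suc fuel) d = if P j then j else searchFrom P (suc j) fuel d

  least1 : (ℕ → Bool) → ℕ → ℕ
  least1 P b = searchFrom P 1 b b

  period : ℕ → ℕ → ℕ
  period N a = least1 (λ j → does (seq N a j ≟ seq N a 0)) (modulus N)

  -- Since seq N a is r-periodic, σ_{q-1} = seq (q + r - 1), σ_{q+1} = seq (q+1).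
  IsMax : ℕ → ℕ → ℕ → Set
  IsMax N a q = seq N a (q + (period N a ∸ 1)) < seq N a q × seq N a (suc q) < seq N a q

  isMaxB : ℕ → ℕ → ℕ → Bool
  isMaxB N a q = does (seq N a (q + (period N a ∸ 1)) <? seq N a q)
               ∧ does (seq N a (suc q) <? seq N a q)

  isMinB : ℕ → ℕ → ℕ → Bool
  isMinB N a q = does (seq N a q <? seq N a (q + (period N a ∸ 1)))
               ∧ does (seq N a q <? seq N a (suc q))

  IsMaxVal : ℕ → ℕ → ℕ → Set
  IsMaxVal N a v = Σ ℕ (λ q → q < period N a × IsMax N a q × seq N a q ≡ v)

  ellS : ℕ → ℕ → ℕ → ℕ
  ellS N a i = least1 (λ j → isMaxB N a (i + period N a ∸ j)) (period N a)

  LS : ℕ → ℕ → ℕ → ℕ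
  LS N a i = seq N a (i + period N a ∸ ellS N a i)

  rhoS : ℕ → ℕ → ℕ → ℕ
  rhoS N a i = least1 (λ j → isMaxB N a (i + j)) (period N a)

  RS : ℕ → ℕ → ℕ → ℕ
  RS N a i = seq N a (i + rhoS N a i)

  SameOrbit : ℕ → ℕ → ℕ → Set
  SameOrbit N a b = Σ ℕ (λ i → (2 ^ i * a) % modulus N ≡ b % modulus N)

  Odd : ℕ → Set
  Odd k = Σ ℕ (λ j → k ≡ suc (2 * j))


open Orbits public

record Field (c ℓ : Level) : Set (lsuc (c ⊔ ℓ)) where
  field
    commutativeRing : CommutativeRing c ℓ
  open CommutativeRing commutativeRing public
  field
    0≉1     : ¬ (0# ≈ 1#)
    inverse : ∀ x → ¬ (x ≈ 0#) → Σ Carrier (λ y → x * y ≈ 1#)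

module FieldNotions {c ℓ : Level} (K : Field c ℓ) where
  open Field K

  natCast : ℕ → Carrier
  natCast zero = 0#
  natCast (suc n) = 1# + natCast n

  pow : Carrier → ℕ → Carrier
  pow x zero = 1#
  pow x (suc n) = x * pow x n

  -- evalMonic (c₀ ∷ … ∷ c_{n-1} ∷ []) x = x^n + c_{n-1} x^{n-1} + … + c₀
  evalMonic : List Carrier → Carrier → Carrier
  evalMonic [] x = 1#
  evalMonic (a ∷ as) x = a + x * evalMonic as x

  AlgClosed : Set (c ⊔ ℓ)
  AlgClosed = ∀ (a : Carrier) (as : List Carrier) → Σ Carrier (λ x → evalMonic (a ∷ as) x ≈ 0#)

  HasChar : ℕ → Set ℓ
  HasChar p = natCast p ≈ 0#

module EModules {c ℓ : Level} (K : Field c ℓ) (p : ℕ) where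
  open Field K
  open FieldNotions K

  frob : ℕ → Carrier → Carrier
  frob j x = pow x (p Nat.^ j)

  -- An element of 𝔼 in normal form
  --   c0 + Σ_i fp[i] F^(i+1) + Σ_j V^(j+1) vp[j]
  -- (every element of 𝔼 is uniquely such a finite sum, as FV = VF = 0).
  record Elt : Set c where
    constructor elt
    field
      c0 : Carrier
      fp : List Carrier
      vp : List Carrier
  open Elt

  coef : List Carrier → ℕ → Carrier
  coef [] _ = 0#
  coef (x ∷ xs) zero = x
  coef (x ∷ xs) (suc i) = coef xs i

  _≈E_ : Elt → Elt → Set ℓ
  e ≈E e' = (c0 e ≈ c0 e') × (∀ i → coef (fp e) i ≈ coef (fp e') i)
                           × (∀ j → coef (vp e) j ≈ coef (vp e') j)

  zipAdd : List Carrier → List Carrier → List Carrier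
  zipAdd [] ys = ys
  zipAdd (x ∷ xs) [] = x ∷ xs
  zipAdd (x ∷ xs) (y ∷ ys) = (x + y) ∷ zipAdd xs ys

  0E : Elt
  0E = elt 0# [] []

  1E : Elt
  1E = elt 1# [] []

  _+E_ : Elt → Elt → Elt
  e +E e' = elt (c0 e + c0 e') (zipAdd (fp e) (fp e')) (zipAdd (vp e) (vp e'))

  -E_ : Elt → Elt
  -E e = elt (- c0 e) (map -_ (fp e)) (map -_ (vp e))

  -- left multiplication by a scalar t ∈ k  (t V^j = V^j t^(p^j))
  scaleV : Carrier → ℕ → List Carrier → List Carrier
  scaleV t j [] = []
  scaleV t j (b ∷ bs) = (frob j t * b) ∷ scaleV t (suc j) bs

  _·E_ : Carrier → Elt → Elt
  t ·E e = elt (t * c0 e) (map (t *_) (fp e)) (scaleV t 1 (vp e))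

  -- left multiplication by F  (F λ = λ^p F, FV = 0)
  FE : Elt → Elt
  FE e = elt 0# (frob 1 (c0 e) ∷ map (frob 1) (fp e)) []

  -- left multiplication by V  (VF = 0)
  VE : Elt → Elt
  VE e = elt 0# [] (c0 e ∷ vp e)

  -- right multiplication by V^m  (λ V^m = V^m λ^(p^m))
  rmulV : ℕ → Elt → Elt
  rmulV zero e = e
  rmulV (suc m) e = elt 0# [] (replicate m 0# ++ (frob (suc m) (c0 e) ∷ map (frob (suc m)) (vp e)))

  -- right multiplication by F^m  (VF = 0)
  rmulF : ℕ → Elt → Elt
  rmulF zero e = e
  rmulF (suc m) e = elt 0# (replicate m 0# ++ (c0 e ∷ fp e)) []

  sumTo : ℕ → (ℕ → Elt) → Elt
  sumTo zero f = 0E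
  sumTo (suc n) f = sumTo n f +E f n

  -- Elements of a free left 𝔼-module on generators e_s (s ∈ Max(σ)):
  -- functions ℕ → 𝔼 giving the coefficient of e_s at s (coordinates
  -- outside Max(σ) are ignored by the equality of 𝔻(σ) below).
  FM : Set c
  FM = ℕ → Elt

  _+M_ : FM → FM → FM
  (x +M y) v = x v +E y v

  _·M_ : Carrier → FM → FM
  (t ·M x) v = t ·E x v

  FM' : FM → FM
  FM' x v = FE (x v)

  VM : FM → FM
  VM x v = VE (x v)

  -- The element  Σ_{s ∈ Min(σ)} co_s · (V^{ℓ(s)} e_{L(s)} + F^{ρ(s)} e_{R(s)})
  -- of the submodule of relations, σ = orbit of a in ℤ/(2^N+1);
  -- minima s = σ_i are indexed by their position i < r.
  relComb : ℕ → ℕ → (ℕ → Elt) → FM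
  relComb N a co v =
    sumTo (period N a) (λ i →
      if isMinB N a i
      then ((if does (v Nat.≟ LS N a i) then rmulV (ellS N a i) (co i) else 0E)
            +E (if does (v Nat.≟ RS N a i) then rmulF (rhoS N a i) (co i) else 0E))
      else 0E)

  -- equality in 𝔻(σ), σ = orbit of a in ℤ/(2^N+1) - {0}:
  -- x - y lies in the left submodule generated by the relations.
  DEq : ℕ → ℕ → FM → FM → Set (c ⊔ ℓ)
  DEq N a x y = Σ (ℕ → Elt) (λ co → ∀ v → IsMaxVal N a v →
                   (x v +E (-E y v)) ≈E relComb N a co v)

  record DIso (N a M b : ℕ) : Set (c ⊔ ℓ) where
    field
      to        : FM → FM
      from      : FM → FM
      to-cong   : ∀ x y → DEq N a x y → DEq M b (to x) (to y)
      from-cong : ∀ x y → DEq M b x y → DEq N a (from x) (from y)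
      to-+      : ∀ x y → DEq M b (to (x +M y)) (to x +M to y)
      to-·      : ∀ t x → DEq M b (to (t ·M x)) (t ·M to x)
      to-F      : ∀ x → DEq M b (to (FM' x)) (FM' (to x))
      to-V      : ∀ x → DEq M b (to (VM x)) (VM (to x))
      from-to   : ∀ x → DEq N a (from (to x)) x
      to-from   : ∀ y → DEq M b (to (from y)) y

-- Write m = 2^c+1 and M = 2^n+1 with n = ck, k odd.  Since x+1 divides
-- x^k+1 for odd k, m divides M, and L = M/m satisfies L·m = M.  The whole
-- lemma rests on one identity: for every t,
--     (L·t) mod M = L·(t mod m),
-- i.e. multiplication by L is an additive embedding ℤ/m → ℤ/M, and the
-- orbit of La is the orbit of a scaled entrywise by L:  2^i·La mod M =
-- L·(2^i·a mod m).  Scaling by L > 0 preserves and reflects equality and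
-- order of integers, so all the combinatorial data defining 𝔻(σ) (period,
-- local maxima and minima, ℓ, ρ, L(s), R(s)) of σ_L are those of σ, with
-- the values multiplied by L.  (For the period one also needs that the
-- bounded search defining it finds its witness 2c already below m.)
-- Hence the relation submodules correspond under v ↦ Lv, and reindexing
-- coordinates x ↦ (v ↦ x(Lv)) is an isomorphism 𝔻(σ_L) ≅ 𝔻(σ).

module Submission where

open import Defs
open import Level using (Level)
open import Data.Nat using (ℕ; zero; suc; _+_; _*_; _^_; _%_; _/_; _≤_; _<_; _∸_;
  z≤n; s≤s; s≤s⁻¹; NonZero; >-nonZero; >-nonZero⁻¹; ≢-nonZero⁻¹; _≟_; _<?_)
open import Data.Nat.Properties
open import Data.Nat.DivMod
open import Data.Nat.Divisibility using (_∣_; ∣-refl; ∣-trans; n∣m*n; 1∣_; ∣m+n∣m⇒∣n)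
open import Data.Nat.Primality using (Prime; prime⇒nonZero)
open import Data.Nat.Solver using (module +-*-Solver)
open import Data.Bool using (Bool; true; false; _∧_; if_then_else_)
open import Data.List using ([]; _∷_; map; replicate; _++_)
open import Data.Product using (Σ; _×_; _,_)
open import Algebra.Properties.CommutativeSemigroup *-commutativeSemigroup using (x∙yz≈y∙xz)
open import Function.Bundles using (mk⇔)
open import Relation.Nullary using (does)
open import Relation.Nullary.Decidable using (dec-true; does-⇔)
open import Relation.Binary.PropositionalEquality

open +-*-Solver using (solve; _:=_; _:+_; _:*_; con)

-- x+1 divides x^(2j+1)+1: from x²·(x^(2j+1)+1) = (x^(2j+3)+1) + (x-1)(x+1).
oddPower-divides : ∀ x j → suc x ∣ suc (x ^ suc (2 * j))
oddPower-divides x zero = subst (λ t → suc x ∣ suc t) (sym (*-identityʳ x)) ∣-refl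
oddPower-divides zero (suc j) = 1∣ _
oddPower-divides x@(suc y) (suc j) = ∣m+n∣m⇒∣n shifted (n∣m*n y)
  where
    z = x ^ suc (2 * j)
    two-steps : x ^ suc (2 * suc j) ≡ x * (x * z)
    two-steps = cong (λ e → x ^ suc e) (+-suc (suc j) (j + 0))
    square-identity : x * x * suc z ≡ y * suc x + suc (x * (x * z))
    square-identity = solve 2 (λ y z → (con 1 :+ y) :* (con 1 :+ y) :* (con 1 :+ z)
      := y :* (con 2 :+ y) :+ (con 1 :+ (con 1 :+ y) :* ((con 1 :+ y) :* z))) refl y z
    shifted : suc x ∣ y * suc x + suc (x ^ suc (2 * suc j))
    shifted rewrite two-steps =
      subst (suc x ∣_) square-identity (∣-trans (oddPower-divides x j) (n∣m*n (x * x)))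

modulus-divides : ∀ c k → Odd k → modulus c ∣ modulus (c * k)
modulus-divides c k (j , refl) =
  subst (λ t → modulus c ∣ suc t) (^-*-assoc 2 c k) (oddPower-divides (2 ^ c) j)

%-divisor-≡ : ∀ t {m m'} .{{_ : NonZero m}} .{{_ : NonZero m'}} → m ≡ m' → t % m ≡ t % m'
%-divisor-≡ t refl = refl

-- x ≡ -1 modulo x+1, hence x² ≡ 1.
square-mod : ∀ x a → (x * x * a) % suc x ≡ a % suc x
square-mod zero a = sym (n%1≡0 a)
square-mod (suc y) a = trans (cong (_% suc (suc y)) expand) ([m+kn]%n≡m%n a (y * a) (suc (suc y)))
  where
    expand : suc y * suc y * a ≡ a + y * a * suc (suc y)
    expand = solve 2 (λ y a → (con 1 :+ y) :* (con 1 :+ y) :* a := a :+ y :* a :* (con 2 :+ y)) refl y a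

-- Every orbit returns to its start after 2N doublings, as 2^(2N) ≡ 1 mod 2^N+1.
orbit-returns : ∀ N a → seq N a (2 * N) ≡ seq N a 0
orbit-returns N a = begin
  (2 ^ (N + (N + 0)) * a) % m  ≡⟨ cong (λ e → (e * a) % m) (^-distribˡ-+-* 2 N (N + 0)) ⟩
  (2 ^ N * 2 ^ (N + 0) * a) % m ≡⟨ cong (λ e → (2 ^ N * 2 ^ e * a) % m) (+-identityʳ N) ⟩
  (2 ^ N * 2 ^ N * a) % m       ≡⟨ square-mod (2 ^ N) a ⟩
  a % m                         ≡⟨ cong (_% m) (*-identityˡ a) ⟨
  (1 * a) % m                   ∎
  where
    open ≡-Reasoning
    m = modulus N

n<2^n : ∀ n → n < 2 ^ n
n<2^n zero = s≤s z≤n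
n<2^n (suc n) = subst (suc (suc n) ≤_) (cong (2 ^ n +_) (sym (+-identityʳ (2 ^ n))))
  (+-mono-≤ (m^n>0 2 n) (n<2^n n))

-- The witness 2N of orbit-returns lies inside the search window of `period`.
double≤modulus : ∀ N → 2 * N ≤ modulus N
double≤modulus zero = z≤n
double≤modulus (suc N) = m≤n⇒m≤1+n (*-monoʳ-≤ 2 (n<2^n N))

searchFrom-cong : ∀ {P Q : ℕ → Bool} → P ≗ Q → ∀ j f d → searchFrom P j f d ≡ searchFrom Q j f d
searchFrom-cong P≗Q j zero d = refl
searchFrom-cong {P} {Q} P≗Q j (suc f) d rewrite P≗Q j with Q j
... | true = refl
... | false = searchFrom-cong P≗Q (suc j) f d

searchFrom-fuel : ∀ (P : ℕ → Bool) t j {f f'} d d' → P (t + j) ≡ true → t < f → f ≤ f' →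
  searchFrom P j f d ≡ searchFrom P j f' d'
searchFrom-fuel P t j {suc f} {suc f'} d d' witness t<f (s≤s f≤f') with P j in Pj
... | true = refl
searchFrom-fuel P zero j d d' witness t<f (s≤s f≤f') | false with trans (sym Pj) witness
... | ()
searchFrom-fuel P (suc t) j d d' witness t<f (s≤s f≤f') | false =
  searchFrom-fuel P t (suc j) d d' (subst (λ u → P u ≡ true) (sym (+-suc t j)) witness) (s≤s⁻¹ t<f) f≤f'

least1-fuel : ∀ (P : ℕ → Bool) {w b b'} → 1 ≤ w → P w ≡ true → w ≤ b → b ≤ b' →
  least1 P b ≡ least1 P b'
least1-fuel P {suc t} _ witness w≤b b≤b' =
  searchFrom-fuel P t 1 _ _ (subst (λ u → P u ≡ true) (+-comm 1 t) witness) w≤b b≤b'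

-- Relations, zero elements and the equality of 𝔻(σ).
module Relations {c ℓ : Level} (K : Field c ℓ) (p : ℕ) .{{_ : NonZero p}} where
  module F = Field K
  open F using (_≈_; 0#)
  open FieldNotions K using (pow)
  open EModules K p

  relTerm : Bool → Bool → ℕ → Bool → ℕ → Elt → Elt
  relTerm isMin atL ℓs atR ρs x =
    if isMin then ((if atL then rmulV ℓs x else 0E) +E (if atR then rmulF ρs x else 0E)) else 0E

  -- relComb N a co v = sumTo (period N a) (relCoord N a co v) by definition.
  relCoord : ℕ → ℕ → (ℕ → Elt) → ℕ → ℕ → Elt
  relCoord N a co v i = relTerm (isMinB N a i) (does (v ≟ LS N a i)) (ellS N a i)
                                (does (v ≟ RS N a i)) (rhoS N a i) (co i)

  relTerm-cong : ∀ {m m' l l' ℓs ℓs' r r' ρs ρs' x} → m ≡ m' → l ≡ l' → ℓs ≡ ℓs' → r ≡ r' → ρs ≡ ρs' →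
    relTerm m l ℓs r ρs x ≡ relTerm m' l' ℓs' r' ρs' x
  relTerm-cong refl refl refl refl refl = refl

  sumTo-cong : ∀ m {f g : ℕ → Elt} → f ≗ g → sumTo m f ≡ sumTo m g
  sumTo-cong zero f≗g = refl
  sumTo-cong (suc m) f≗g = cong₂ _+E_ (sumTo-cong m f≗g) (f≗g m)

  -- e = 0 in 𝔼, componentwise (a record, so that e is recoverable from the type).
  record IsZero (e : Elt) : Set ℓ where
    constructor is-zero
    field
      c0≈0 : Elt.c0 e ≈ 0#
      fp≈0 : ∀ i → coef (Elt.fp e) i ≈ 0#
      vp≈0 : ∀ j → coef (Elt.vp e) j ≈ 0#

  ≈E-zeros : ∀ {e e'} → IsZero e → IsZero e' → e ≈E e'
  ≈E-zeros (is-zero z zf zv) (is-zero z' zf' zv') =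
    F.trans z (F.sym z') , (λ i → F.trans (zf i) (F.sym (zf' i))) , (λ j → F.trans (zv j) (F.sym (zv' j)))

  +-zero : ∀ {x y} → x ≈ 0# → y ≈ 0# → x F.+ y ≈ 0#
  +-zero x≈0 y≈0 = F.trans (F.+-cong x≈0 y≈0) (F.+-identityˡ 0#)

  coef-zipAdd : ∀ xs ys i → coef (zipAdd xs ys) i ≈ coef xs i F.+ coef ys i
  coef-zipAdd [] ys i = F.sym (F.+-identityˡ _)
  coef-zipAdd (x ∷ xs) [] i = F.sym (F.+-identityʳ _)
  coef-zipAdd (x ∷ xs) (y ∷ ys) zero = F.refl
  coef-zipAdd (x ∷ xs) (y ∷ ys) (suc i) = coef-zipAdd xs ys i

  zipAdd-zero : ∀ xs ys → (∀ i → coef xs i ≈ 0#) → (∀ i → coef ys i ≈ 0#) →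
    ∀ i → coef (zipAdd xs ys) i ≈ 0#
  zipAdd-zero xs ys xs≈0 ys≈0 i = F.trans (coef-zipAdd xs ys i) (+-zero (xs≈0 i) (ys≈0 i))

  +E-zero : ∀ {e e'} → IsZero e → IsZero e' → IsZero (e +E e')
  +E-zero {e} {e'} (is-zero z zf zv) (is-zero z' zf' zv') =
    is-zero (+-zero z z') (zipAdd-zero (Elt.fp e) (Elt.fp e') zf zf') (zipAdd-zero (Elt.vp e) (Elt.vp e') zv zv')

  coef-cancel : ∀ xs i → coef (zipAdd xs (map F.-_ xs)) i ≈ 0#
  coef-cancel [] i = F.refl
  coef-cancel (x ∷ xs) zero = F.-‿inverseʳ x
  coef-cancel (x ∷ xs) (suc i) = coef-cancel xs i

  +E-inverse : ∀ e → IsZero (e +E (-E e))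
  +E-inverse e = is-zero (F.-‿inverseʳ _) (coef-cancel (Elt.fp e)) (coef-cancel (Elt.vp e))

  0E-zero : IsZero 0E
  0E-zero = is-zero F.refl (λ _ → F.refl) (λ _ → F.refl)

  if-zero : ∀ b {e e'} → IsZero e → IsZero e' → IsZero (if b then e else e')
  if-zero true e≈0 e'≈0 = e≈0
  if-zero false e≈0 e'≈0 = e'≈0

  padded-zero : ∀ m ys → (∀ j → coef ys j ≈ 0#) → ∀ j → coef (replicate m 0# ++ ys) j ≈ 0#
  padded-zero zero ys ys≈0 j = ys≈0 j
  padded-zero (suc m) ys ys≈0 zero = F.refl
  padded-zero (suc m) ys ys≈0 (suc j) = padded-zero m ys ys≈0 j

  singleton-zero : ∀ {x} → x ≈ 0# → ∀ j → coef (x ∷ []) j ≈ 0#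
  singleton-zero x≈0 zero = x≈0
  singleton-zero x≈0 (suc j) = F.refl

  pow-zero : ∀ e → 0 < e → pow 0# e ≈ 0#
  pow-zero (suc e) _ = F.zeroˡ _

  rmulV-zero : ∀ m → IsZero (rmulV m 0E)
  rmulV-zero zero = 0E-zero
  rmulV-zero (suc m) =
    is-zero F.refl (λ _ → F.refl) (padded-zero m _ (singleton-zero (pow-zero (p ^ suc m) (m^n>0 p (suc m)))))

  rmulF-zero : ∀ m → IsZero (rmulF m 0E)
  rmulF-zero zero = 0E-zero
  rmulF-zero (suc m) = is-zero F.refl (padded-zero m _ (singleton-zero F.refl)) (λ _ → F.refl)

  sumTo-zero : ∀ m {f} → (∀ i → IsZero (f i)) → IsZero (sumTo m f)
  sumTo-zero zero f≈0 = 0E-zero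
  sumTo-zero (suc m) f≈0 = +E-zero (sumTo-zero m f≈0) (f≈0 m)

  relTerm-zero : ∀ isMin atL ℓs atR ρs → IsZero (relTerm isMin atL ℓs atR ρs 0E)
  relTerm-zero isMin atL ℓs atR ρs = if-zero isMin
    (+E-zero (if-zero atL (rmulV-zero ℓs) 0E-zero) (if-zero atR (rmulF-zero ρs) 0E-zero)) 0E-zero

  relComb-zero : ∀ N a v → IsZero (relComb N a (λ _ → 0E) v)
  relComb-zero N a v = sumTo-zero (period N a) {relCoord N a (λ _ → 0E) v} λ i →
    relTerm-zero (isMinB N a i) (does (v ≟ LS N a i)) (ellS N a i) (does (v ≟ RS N a i)) (rhoS N a i)

  DEq-pointwise : ∀ N a x y → (∀ v → IsMaxVal N a v → x v ≡ y v) → DEq N a x y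
  DEq-pointwise N a x y x≡y = (λ _ → 0E) , λ v v-max →
    ≈E-zeros (subst (λ e → IsZero (x v +E (-E e))) (x≡y v v-max) (+E-inverse (x v))) (relComb-zero N a v)

module Scaling (c n L : ℕ) (c≥1 : 1 ≤ c) (scale : L * modulus c ≡ modulus n) where
  m = modulus c
  M = modulus n

  M≡mL : M ≡ m * L
  M≡mL = trans (sym scale) (*-comm L m)

  instance
    mL≢0 : NonZero (m * L)
    mL≢0 = subst NonZero M≡mL _
    L≢0 : NonZero L
    L≢0 = m*n≢0⇒n≢0 m

  scale-mod : ∀ t → (L * t) % M ≡ L * (t % m)
  scale-mod t = begin
    (L * t) % M       ≡⟨ cong (_% M) (*-comm L t) ⟩
    (t * L) % M       ≡⟨ %-divisor-≡ (t * L) M≡mL ⟩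
    (t * L) % (m * L) ≡⟨ m%n*o≡m*o%[n*o] t m L ⟨
    t % m * L         ≡⟨ *-comm (t % m) L ⟩
    L * (t % m)       ∎
    where open ≡-Reasoning

  ≟-scale : ∀ x y → does (L * x ≟ L * y) ≡ does (x ≟ y)
  ≟-scale x y = does-⇔ (mk⇔ (*-cancelˡ-≡ x y L) (cong (L *_))) (L * x ≟ L * y) (x ≟ y)

  <?-scale : ∀ x y → does (L * x <? L * y) ≡ does (x <? y)
  <?-scale x y = does-⇔ (mk⇔ (*-cancelˡ-< L x y) (*-monoʳ-< L)) (L * x <? L * y) (x <? y)

  seq-scale : ∀ a i → seq n (L * a) i ≡ L * seq c a i
  seq-scale a i = begin
    (2 ^ i * (L * a)) % M ≡⟨ cong (_% M) (x∙yz≈y∙xz (2 ^ i) L a) ⟩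
    (L * (2 ^ i * a)) % M ≡⟨ scale-mod (2 ^ i * a) ⟩
    L * seq c a i         ∎
    where open ≡-Reasoning

  module Orbit (a : ℕ) where
    La = L * a

    lt-scale : ∀ i j → does (seq n La i <? seq n La j) ≡ does (seq c a i <? seq c a j)
    lt-scale i j = trans (cong₂ (λ u w → does (u <? w)) (seq-scale a i) (seq-scale a j)) (<?-scale _ _)

    -- Same period: the predicates agree, and the search mod m already
    -- finds the witness 2c, so the larger window mod M changes nothing.
    period-scale : period n La ≡ period c a
    period-scale = trans (searchFrom-cong returns-scale 1 M M)
      (sym (least1-fuel returns 1≤2c witness 2c≤m m≤M))
      where
        returns : ℕ → Bool
        returns j = does (seq c a j ≟ seq c a 0)
        returns-scale : (λ j → does (seq n La j ≟ seq n La 0)) ≗ returns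
        returns-scale j = trans (cong₂ (λ u w → does (u ≟ w)) (seq-scale a j) (seq-scale a 0)) (≟-scale _ _)
        1≤2c : 1 ≤ 2 * c
        1≤2c = ≤-trans c≥1 (m≤n*m c 2)
        witness : returns (2 * c) ≡ true
        witness = dec-true (seq c a (2 * c) ≟ seq c a 0) (orbit-returns c a)
        2c≤m : 2 * c ≤ m
        2c≤m = double≤modulus c
        m≤M : m ≤ M
        m≤M = subst (m ≤_) scale (m≤n*m m L)

    isMaxB-scale : ∀ q → isMaxB n La q ≡ isMaxB c a q
    isMaxB-scale q = cong₂ _∧_
      (trans (cong (λ r → does (seq n La (q + (r ∸ 1)) <? seq n La q)) period-scale)
             (lt-scale (q + (period c a ∸ 1)) q))
      (lt-scale (suc q) q)

    isMinB-scale : ∀ q → isMinB n La q ≡ isMinB c a q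
    isMinB-scale q = cong₂ _∧_
      (trans (cong (λ r → does (seq n La q <? seq n La (q + (r ∸ 1)))) period-scale)
             (lt-scale q (q + (period c a ∸ 1))))
      (lt-scale q (suc q))

    ellS-scale : ∀ i → ellS n La i ≡ ellS c a i
    ellS-scale i = trans (searchFrom-cong max-before 1 (period n La) (period n La))
      (cong (least1 (λ j → isMaxB c a (i + period c a ∸ j))) period-scale)
      where
        max-before : (λ j → isMaxB n La (i + period n La ∸ j)) ≗ (λ j → isMaxB c a (i + period c a ∸ j))
        max-before j = trans (cong (λ r → isMaxB n La (i + r ∸ j)) period-scale) (isMaxB-scale (i + period c a ∸ j))

    rhoS-scale : ∀ i → rhoS n La i ≡ rhoS c a i
    rhoS-scale i = trans (searchFrom-cong (λ j → isMaxB-scale (i + j)) 1 (period n La) (period n La))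
      (cong (least1 (λ j → isMaxB c a (i + j))) period-scale)

    LS-scale : ∀ i → LS n La i ≡ L * LS c a i
    LS-scale i = trans (cong₂ (λ r e → seq n La (i + r ∸ e)) period-scale (ellS-scale i))
      (seq-scale a (i + period c a ∸ ellS c a i))

    RS-scale : ∀ i → RS n La i ≡ L * RS c a i
    RS-scale i = trans (cong (λ e → seq n La (i + e)) (rhoS-scale i)) (seq-scale a (i + rhoS c a i))

    IsMax-up : ∀ q → IsMax c a q → IsMax n La q
    IsMax-up q (before , after) rewrite period-scale | seq-scale a (q + (period c a ∸ 1))
      | seq-scale a q | seq-scale a (suc q) = *-monoʳ-< L before , *-monoʳ-< L after

    IsMax-down : ∀ q → IsMax n La q → IsMax c a q
    IsMax-down q (before , after) rewrite period-scale | seq-scale a (q + (period c a ∸ 1))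
      | seq-scale a q | seq-scale a (suc q) = *-cancelˡ-< L _ _ before , *-cancelˡ-< L _ _ after

    max-up : ∀ v → IsMaxVal c a v → IsMaxVal n La (L * v)
    max-up v (q , q<r , q-max , refl) =
      q , subst (q <_) (sym period-scale) q<r , IsMax-up q q-max , seq-scale a q

    max-down : ∀ w → IsMaxVal n La w → Σ ℕ (λ v → w ≡ L * v × IsMaxVal c a v)
    max-down w (q , q<r , q-max , refl) =
      seq c a q , seq-scale a q , (q , subst (q <_) period-scale q<r , IsMax-down q q-max , refl)

  -- Division by L undoes scaling; it defines the inverse isomorphism.
  unscale : ∀ v → L * v / L ≡ v
  unscale v = trans (cong (_/ L) (*-comm L v)) (m*n/n≡m v L)

  scale-additive : ∀ α β → (L * ((α + β) % m)) % M ≡ (L * α + L * β) % M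
  scale-additive α β = begin
    (L * ((α + β) % m)) % M ≡⟨ scale-mod _ ⟩
    L * ((α + β) % m % m)   ≡⟨ cong (L *_) (m%n%n≡m%n (α + β) m) ⟩
    L * ((α + β) % m)       ≡⟨ scale-mod (α + β) ⟨
    (L * (α + β)) % M       ≡⟨ cong (_% M) (*-distribˡ-+ L α β) ⟩
    (L * α + L * β) % M     ∎
    where open ≡-Reasoning

  scale-small : ∀ {α} → α < m → (L * α) % M ≡ L * α
  scale-small {α} α<m = trans (scale-mod α) (cong (L *_) (m<n⇒m%n≡m α<m))

  -- The remaining items of the lemma, stated without unused hypotheses.
  scale-injective : ∀ α β → α < m → β < m → (L * α) % M ≡ (L * β) % M → α ≡ β
  scale-injective α β α<m β<m e =
    *-cancelˡ-≡ α β L (trans (sym (scale-small α<m)) (trans e (scale-small β<m)))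

  scale-nonzero : ∀ a → 1 ≤ a → a ≤ 2 ^ c → (L * a) % M ≢ 0
  scale-nonzero a 1≤a a≤2^c = subst (_≢ 0) (sym (scale-small (s≤s a≤2^c)))
    (≢-nonZero⁻¹ (L * a) {{m*n≢0 L a {{L≢0}} {{>-nonZero 1≤a}}}})

  orbit-scale : ∀ a b → SameOrbit c a b → SameOrbit n (L * a) (L * b)
  orbit-scale a b (i , e) = i , trans (seq-scale a i) (trans (cong (L *_) e) (sym (scale-mod b)))

  orbit-unscale : ∀ a b → SameOrbit n (L * a) (L * b) → SameOrbit c a b
  orbit-unscale a b (i , e) = i , *-cancelˡ-≡ _ _ L (trans (sym (seq-scale a i)) (trans e (scale-mod b)))

  -- Every nonzero element of Lℤ/M is L·(α mod m), which lies in its own orbit.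
  orbit-surjective : ∀ x → 1 ≤ x → x ≤ 2 ^ n → Σ ℕ (λ α → x ≡ (L * α) % M) →
    Σ ℕ (λ a → 1 ≤ a × a ≤ 2 ^ c × SameOrbit n (L * a) x)
  orbit-surjective x 1≤x x≤2^n (α , x≡Lα) =
    a , positive , s≤s⁻¹ (m%n<n α m) , (0 , trans (cong (_% M) (*-identityˡ (L * a))) x≡La%M)
    where
      a = α % m
      x≡La : x ≡ L * a
      x≡La = trans x≡Lα (scale-mod α)
      x≡La%M : (L * a) % M ≡ x % M
      x≡La%M = trans (scale-small (m%n<n α m)) (trans (sym x≡La) (sym (m<n⇒m%n≡m (s≤s x≤2^n))))
      positive : 1 ≤ a
      positive = >-nonZero⁻¹ a {{m*n≢0⇒n≢0 L {{subst NonZero x≡La (>-nonZero 1≤x)}}}}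

-- 𝔻(σ_L) ≅ 𝔻(σ): reindexing coordinates along v ↦ Lv matches relations.
module ModuleIso {ℓ₁ ℓ₂ : Level} (K : Field ℓ₁ ℓ₂) (p : ℕ) .{{_ : NonZero p}}
                 (c n L : ℕ) (c≥1 : 1 ≤ c) (scale : L * modulus c ≡ modulus n) where
  open EModules K p
  open Relations K p
  open Scaling c n L c≥1 scale

  module _ (a : ℕ) where
    open Orbit a

    relComb-scale : ∀ co v → relComb n La co (L * v) ≡ relComb c a co v
    relComb-scale co v = trans (cong (λ r → sumTo r (relCoord n La co (L * v))) period-scale)
      (sumTo-cong (period c a) λ i → relTerm-cong (isMinB-scale i)
        (trans (cong (λ u → does (L * v ≟ u)) (LS-scale i)) (≟-scale v (LS c a i)))
        (ellS-scale i)
        (trans (cong (λ u → does (L * v ≟ u)) (RS-scale i)) (≟-scale v (RS c a i)))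
        (rhoS-scale i))

    restrict : FM → FM
    restrict x v = x (L * v)

    extend : FM → FM
    extend y w = y (w / L)

    -- Both maps respect the relations, by relComb-scale and the matching maxima.
    restrict-cong : ∀ x y → DEq n La x y → DEq c a (restrict x) (restrict y)
    restrict-cong x y (co , rel) = co , λ v v-max →
      subst (λ r → (x (L * v) +E (-E y (L * v))) ≈E r) (relComb-scale co v) (rel (L * v) (max-up v v-max))

    extend-cong : ∀ x y → DEq c a x y → DEq n La (extend x) (extend y)
    extend-cong x y (co , rel) = co , λ w w-max → at (max-down w w-max)
      where
        at : ∀ {w} → Σ ℕ (λ v → w ≡ L * v × IsMaxVal c a v) →
          (x (w / L) +E (-E y (w / L))) ≈E relComb n La co w
        at (v , refl , v-max) rewrite unscale v | relComb-scale co v = rel v v-max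

    extend-restrict : ∀ x → DEq n La (extend (restrict x)) x
    extend-restrict x = DEq-pointwise n La (extend (restrict x)) x λ w w-max → at (max-down w w-max)
      where
        at : ∀ {w} → Σ ℕ (λ v → w ≡ L * v × IsMaxVal c a v) → x (L * (w / L)) ≡ x w
        at (v , refl , _) = cong (λ u → x (L * u)) (unscale v)

    D-iso : DIso n La c a
    D-iso = record
      { to = restrict
      ; from = extend
      ; to-cong = restrict-cong
      ; from-cong = extend-cong
      ; to-+ = λ x y → DEq-pointwise c a (restrict (x +M y)) (restrict x +M restrict y) λ _ _ → refl
      ; to-· = λ t x → DEq-pointwise c a (restrict (t ·M x)) (t ·M restrict x) λ _ _ → refl
      ; to-F = λ x → DEq-pointwise c a (restrict (FM' x)) (FM' (restrict x)) λ _ _ → refl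
      ; to-V = λ x → DEq-pointwise c a (restrict (VM x)) (VM (restrict x)) λ _ _ → refl
      ; from-to = extend-restrict
      ; to-from = λ y → DEq-pointwise c a (restrict (extend y)) y λ v _ → cong y (unscale v)
      }

lemma5p9 : ∀ {ℓ₁ ℓ₂ : Level} (K : Field ℓ₁ ℓ₂) (p : ℕ) → Prime p →
    FieldNotions.HasChar K p → FieldNotions.AlgClosed K →
    ∀ (c k n : ℕ) → 1 ≤ c → Odd k → n ≡ c * k →
    let L = suc (2 ^ n) / suc (2 ^ c) in
    (∀ α β → (L * ((α + β) % modulus c)) % modulus n ≡ (L * α + L * β) % modulus n)
    × (∀ α β → α < modulus c → β < modulus c →
         (L * α) % modulus n ≡ (L * β) % modulus n → α ≡ β)
    × (∀ a b → 1 ≤ a → a ≤ 2 ^ c → 1 ≤ b → b ≤ 2 ^ c →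
         SameOrbit c a b → SameOrbit n (L * a) (L * b))
    × (∀ a → 1 ≤ a → a ≤ 2 ^ c → (L * a) % modulus n ≢ 0)
    × (∀ a b → 1 ≤ a → a ≤ 2 ^ c → 1 ≤ b → b ≤ 2 ^ c →
         SameOrbit n (L * a) (L * b) → SameOrbit c a b)
    × (∀ x → 1 ≤ x → x ≤ 2 ^ n → Σ ℕ (λ α → x ≡ (L * α) % modulus n) →
         Σ ℕ (λ a → 1 ≤ a × a ≤ 2 ^ c × SameOrbit n (L * a) x))
    × (∀ a → 1 ≤ a → a ≤ 2 ^ c → EModules.DIso K p n (L * a) c a)
lemma5p9 K p p-prime _ _ c k .(c * k) c≥1 k-odd refl =
  scale-additive , scale-injective ,
  (λ a b _ _ _ _ → orbit-scale a b) , scale-nonzero ,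
  (λ a b _ _ _ _ → orbit-unscale a b) , orbit-surjective ,
  (λ a _ _ → D-iso a)
  where
    n = c * k
    L = suc (2 ^ n) / suc (2 ^ c)
    -- L·(2^c+1) = 2^n+1 because 2^c+1 divides 2^(ck)+1 for odd k.
    scale : L * modulus c ≡ modulus n
    scale = m/n*n≡m (modulus-divides c k k-odd)
    open Scaling c n L c≥1 scale
    open ModuleIso K p {{prime⇒nonZero p-prime}} c n L c≥1 scale
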